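{- Let $V$ be any variety in $\mathbb{P}^b$ over $\overline{\mathbb{F}}_q$, and let $g$ be a uniformly random homogeneous polynomial of degree $m$ in $x_0,\dotsc,x_b$ with coefficients in $\mathbb{F}_q$. Then $\Pr[g|_V=0]\leq q^{ -H_{I(V)}(m)}$.
   Context: $I(V)$ is the homogeneous ideal of polynomials in $\overline{\mathbb{F}}_q[x_0,\dotsc,x_b]$ vanishing on $V$. The Hilbert function $H_I(m)$ of a homogeneous ideal $I$ is the codimension of $I\cap\overline{\mathbb{F}}_q[x_0,\dotsc,x_b]_m$ in the space $\overline{\mathbb{F}}_q[x_0,\dotsc,x_b]_m$ of homogeneous degree-$m$ polynomials. -}

module Defs where

open import Level using (0ℓ)
open import Algebra.Bundles using (CommutativeRing)
open import Data.Nat using (ℕ; zero; suc; _∸_; _≤_)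
import Data.List as L
import Data.Fin as Fin
open import Data.Empty using (⊥)
open import Data.Fin using (Fin)
open import Data.List using (List; []; _∷_; length; map; concatMap; upTo; foldr)
open import Data.List.Relation.Unary.AllPairs using (AllPairs)
open import Data.Vec using (Vec; []; _∷_; lookup)
open import Data.Product using (Σ; ∃; _×_; _,_)
open import Relation.Nullary using (¬_)
open import Relation.Binary.PropositionalEquality using (_≡_)

record IsField (R : CommutativeRing 0ℓ 0ℓ) : Set where
  open CommutativeRing R
  field
    0≉1     : ¬ (0# ≈ 1#)
    inverse : ∀ x → ¬ (x ≈ 0#) → ∃ λ y → (x * y) ≈ 1#

record IsFiniteFieldOfSize (F : CommutativeRing 0ℓ 0ℓ) (q : ℕ) : Set where
  open CommutativeRing F
  field
    isField : IsField F
    enum    : Fin q → Carrier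
    enum-inj : ∀ i j → enum i ≈ enum j → i ≡ j
    enum-surj : ∀ x → ∃ λ i → enum i ≈ x

record IsRingHom (F K : CommutativeRing 0ℓ 0ℓ)
                 (ι : CommutativeRing.Carrier F → CommutativeRing.Carrier K) : Set where
  module F = CommutativeRing F
  module K = CommutativeRing K
  field
    cong-ι : ∀ {x y} → x F.≈ y → ι x K.≈ ι y
    pres-+ : ∀ x y → ι (x F.+ y) K.≈ (ι x K.+ ι y)
    pres-* : ∀ x y → ι (x F.* y) K.≈ (ι x K.* ι y)
    pres-1 : ι F.1# K.≈ K.1#

-- Univariate polynomials as coefficient lists c₀ ∷ c₁ ∷ … ∷ cₙ

module _ (K : CommutativeRing 0ℓ 0ℓ) where
  open CommutativeRing K

  evalU : List Carrier → Carrier → Carrier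
  evalU []       x = 0#
  evalU (c ∷ cs) x = c + (x * evalU cs x)

  lastC : Carrier → List Carrier → Carrier
  lastC c []       = c
  lastC c (d ∷ ds) = lastC d ds

  Nonconstant : Carrier → List Carrier → Set
  Nonconstant c []       = ⊥
  Nonconstant c (d ∷ ds) = ¬ (lastC d ds ≈ 0#)

  IsAlgClosed : Set
  IsAlgClosed = ∀ c cs → Nonconstant c cs → ∃ λ x → evalU (c ∷ cs) x ≈ 0#

record IsAlgebraicClosure (F K : CommutativeRing 0ℓ 0ℓ)
         (ι : CommutativeRing.Carrier F → CommutativeRing.Carrier K) : Set where
  module F = CommutativeRing F
  module K = CommutativeRing K
  field
    isField   : IsField K
    isHom     : IsRingHom F K ι
    algClosed : IsAlgClosed K
    algebraic : ∀ (x : K.Carrier) → ∃ λ (c : F.Carrier) → ∃ λ (cs : List F.Carrier) →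
                  Nonconstant F c cs × (evalU K (map ι (c ∷ cs)) x K.≈ K.0#)

monos : (b m : ℕ) → List (Vec ℕ (suc b))
monos zero    m = (m ∷ []) ∷ []
monos (suc b) m = concatMap (λ k → map (k ∷_) (monos b (m ∸ k))) (upTo (suc m))

D : ℕ → ℕ → ℕ
D b m = length (monos b m)

-- a homogeneous form of degree m = a coefficient for each monomial
Form : (R : CommutativeRing 0ℓ 0ℓ) → ℕ → ℕ → Set
Form R b m = Fin (D b m) → CommutativeRing.Carrier R

module _ (K : CommutativeRing 0ℓ 0ℓ) where
  open CommutativeRing K

  pow : Carrier → ℕ → Carrier
  pow x zero    = 1#
  pow x (suc n) = x * pow x n

  monoVal : ∀ {n} → Vec ℕ n → Vec Carrier n → Carrier
  monoVal []       []       = 1#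
  monoVal (e ∷ es) (x ∷ xs) = pow x e * monoVal es xs

  sumFin : ∀ n → (Fin n → Carrier) → Carrier
  sumFin zero    f = 0#
  sumFin (suc n) f = f Fin.zero + sumFin n (λ i → f (Fin.suc i))

  evalForm : ∀ {b m} → Form K b m → Vec Carrier (suc b) → Carrier
  evalForm {b} {m} f x = sumFin (D b m) (λ i → f i * monoVal (L.lookup (monos b m) i) x)

  record ProjVariety (b : ℕ) : Set₁ where
    field
      J    : Set
      deg  : J → ℕ
      eqns : (j : J) → Form K b (deg j)

  NonzeroVec : ∀ {n} → Vec Carrier n → Set
  NonzeroVec x = ∃ λ i → ¬ (lookup x i ≈ 0#)

  -- points of V (represented by nonzero affine representatives)
  InV : ∀ {b} → ProjVariety b → Vec Carrier (suc b) → Set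
  InV {b} V x = NonzeroVec x × (∀ j → evalForm {b} {ProjVariety.deg V j} (ProjVariety.eqns V j) x ≈ 0#)

  -- f lies in I(V) (degree m part): f vanishes at every point of V
  VanishesOn : ∀ {b m} → Form K b m → ProjVariety b → Set
  VanishesOn {b} {m} f V = ∀ x → InV V x → evalForm {b} {m} f x ≈ 0#

  linComb : ∀ {b m h} → (Fin h → Carrier) → (Fin h → Form K b m) → Form K b m
  linComb {h = h} c f k = sumFin h (λ i → c i * f i k)

  IndepMod : ∀ {b m h} → ProjVariety b → (Fin h → Form K b m) → Set
  IndepMod {b} {m} {h} V f = ∀ c → VanishesOn {b} {m} (linComb {b} {m} {h} c f) V → ∀ i → c i ≈ 0#

  -- H_{I(V)}(m) = H : the codimension of I(V)_m in the space of degree-m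
  -- forms, i.e. the maximal size of a family of degree-m forms linearly
  -- independent modulo I(V)_m.
  record IsHilbertValue {b : ℕ} (V : ProjVariety b) (m H : ℕ) : Set where
    field
      witness : Σ (Fin H → Form K b m) (IndepMod {b} {m} {H} V)
      maximal : ∀ h (f : Fin h → Form K b m) → IndepMod {b} {m} {h} V f → h ≤ H

module _ (F K : CommutativeRing 0ℓ 0ℓ)
         (ι : CommutativeRing.Carrier F → CommutativeRing.Carrier K) where
  open CommutativeRing F

  liftForm : ∀ {b m} → Form F b m → Form K b m
  liftForm g k = ι (g k)

  DistinctForms : ∀ {b m} → Form F b m → Form F b m → Set
  DistinctForms {b} {m} g g' = ∃ λ (k : Fin (D b m)) → ¬ (g k ≈ g' k)

  RestrictsToZero : ∀ {b m} → ProjVariety K b → Form F b m → Set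
  RestrictsToZero {b} {m} V g = VanishesOn K {b} {m} (liftForm {b} {m} g) V

{-# OPTIONS --safe #-}
module Submission where

-- Let n be the number of degree-m monomials, so that forms are vectors in K^n, and let U ⊆ K^n
-- be the space of forms vanishing on V; the Hilbert value H supplies H forms independent modulo U.
-- The F-rational vectors of any subspace U of K^n modulo which h vectors are independent number
-- at most q^(n-h); this is proved by induction on n, splitting off the first coordinate.
-- If some u ∈ U has u₀ ≠ 0, the rational points of U fall into q classes according to their first
-- coordinate, each class is a translate of the rational points of U ∩ {x₀ = 0}, and clearing the
-- first coordinates of the independent vectors with u keeps all h of them independent modulo that
-- section.  Otherwise U ⊆ {x₀ = 0}, and clearing the first coordinates with an independent vector
-- whose first coordinate is nonzero (if there is one) costs only that vector.  Neither case split
-- is decidable in K, so both are made under double negation, which the decidable conclusion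
-- (an inequality of natural numbers) absorbs.

open import Defs
open import Level using (0ℓ)
open import Algebra.Bundles using (CommutativeRing)
open import Data.Nat using (ℕ)

module LinearAlgebra (R : CommutativeRing 0ℓ 0ℓ) where
  open CommutativeRing R hiding (zero)
  open import Algebra.Properties.Ring ring using (-‿distribˡ-*; -1*x≈-x)
  open import Algebra.Properties.Group +-group using (//-rightDividesʳ)
  open import Algebra.Properties.Semiring.Sum semiring
    using (sum; sum-cong-≋; sum-replicate-zero; ∑-distrib-+; *-distribˡ-sum; *-distribʳ-sum; sum-remove)
  open import Data.Nat using (zero; suc)
  open import Data.Fin using (Fin; zero; suc; punchIn)
  open import Data.Fin.Properties using (∀-cons)
  open import Data.Vec.Functional using (Vector; _∷_; tail; removeAt; insertAt)
  open import Data.Vec.Functional.Properties using (insertAt-lookup; insertAt-punchIn)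
  open import Data.Vec.Functional.Relation.Binary.Equality.Setoid setoid using (_≋_)
  open import Function using (_∘_)
  open import Relation.Binary.PropositionalEquality as ≡ using (_≡_; cong)
  open import Relation.Binary.Reasoning.Setoid setoid
  open import Relation.Unary using (Pred; _∈_)

  ∑ : ∀ n → Vector Carrier n → Carrier
  ∑ = sumFin R

  ∑≡sum : ∀ n (f : Vector Carrier n) → ∑ n f ≡ sum f
  ∑≡sum zero    f = ≡.refl
  ∑≡sum (suc n) f = cong (f zero +_) (∑≡sum n (f ∘ suc))

  ∑-cong : ∀ n {f g : Vector Carrier n} → f ≋ g → ∑ n f ≈ ∑ n g
  ∑-cong n {f} {g} f≋g rewrite ∑≡sum n f | ∑≡sum n g = sum-cong-≋ f≋g

  ∑-zero : ∀ n → ∑ n (λ _ → 0#) ≈ 0#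
  ∑-zero n rewrite ∑≡sum n (λ _ → 0#) = sum-replicate-zero n

  ∑-+ : ∀ n (f g : Vector Carrier n) → ∑ n (λ i → f i + g i) ≈ ∑ n f + ∑ n g
  ∑-+ n f g rewrite ∑≡sum n (λ i → f i + g i) | ∑≡sum n f | ∑≡sum n g = ∑-distrib-+ f g

  *-distribˡ-∑ : ∀ n x (f : Vector Carrier n) → x * ∑ n f ≈ ∑ n (λ i → x * f i)
  *-distribˡ-∑ n x f rewrite ∑≡sum n f | ∑≡sum n (λ i → x * f i) = *-distribˡ-sum x f

  *-distribʳ-∑ : ∀ n x (f : Vector Carrier n) → ∑ n f * x ≈ ∑ n (λ i → f i * x)
  *-distribʳ-∑ n x f rewrite ∑≡sum n f | ∑≡sum n (λ i → f i * x) = *-distribʳ-sum x f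

  ∑-remove : ∀ n (i : Fin (suc n)) (f : Vector Carrier (suc n)) → ∑ (suc n) f ≈ f i + ∑ n (removeAt f i)
  ∑-remove n i f rewrite ∑≡sum (suc n) f | ∑≡sum n (removeAt f i) = sum-remove f

  infixl 6 _+ᵛ_ _-ᵛ_
  infixr 7 _•_
  infix  8 _·_

  _+ᵛ_ : ∀ {n} → Vector Carrier n → Vector Carrier n → Vector Carrier n
  (u +ᵛ v) k = u k + v k

  _•_ : ∀ {n} → Carrier → Vector Carrier n → Vector Carrier n
  (s • v) k = s * v k

  _-ᵛ_ : ∀ {n} → Vector Carrier n → Vector Carrier n → Vector Carrier n
  u -ᵛ v = u +ᵛ (- 1#) • v

  -ᵛ-pointwise : ∀ {n} (u v : Vector Carrier n) k → (u -ᵛ v) k ≈ u k - v k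
  -ᵛ-pointwise u v k = +-congˡ (-1*x≈-x (v k))

  0ᵛ : ∀ {n} → Vector Carrier n
  0ᵛ _ = 0#

  _·_ : ∀ {n} → Vector Carrier n → Vector Carrier n → Carrier
  _·_ {n} u v = ∑ n (λ i → u i * v i)

  ·-congʳ : ∀ {n} {u v : Vector Carrier n} w → u ≋ v → u · w ≈ v · w
  ·-congʳ {n} w u≋v = ∑-cong n (λ i → *-congʳ (u≋v i))

  0ᵛ-· : ∀ {n} (w : Vector Carrier n) → 0ᵛ · w ≈ 0#
  0ᵛ-· {n} w = trans (∑-cong n (λ i → zeroˡ (w i))) (∑-zero n)

  +ᵛ-· : ∀ {n} (u v w : Vector Carrier n) → (u +ᵛ v) · w ≈ u · w + v · w
  +ᵛ-· {n} u v w = trans (∑-cong n (λ i → distribʳ (w i) (u i) (v i))) (∑-+ n _ _)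

  •-· : ∀ {n} s (u w : Vector Carrier n) → (s • u) · w ≈ s * (u · w)
  •-· {n} s u w = trans (∑-cong n (λ i → *-assoc s (u i) (w i))) (sym (*-distribˡ-∑ n s _))

  record IsSubspace {n} (U : Pred (Vector Carrier n) 0ℓ) : Set where
    field
      ∈-resp-≋  : ∀ {u v} → u ≋ v → u ∈ U → v ∈ U
      0ᵛ∈       : 0ᵛ ∈ U
      +ᵛ-closed : ∀ {u v} → u ∈ U → v ∈ U → u +ᵛ v ∈ U
      •-closed  : ∀ s {u} → u ∈ U → s • u ∈ U

    -ᵛ-closed : ∀ {u v} → u ∈ U → v ∈ U → u -ᵛ v ∈ U
    -ᵛ-closed u∈U v∈U = +ᵛ-closed u∈U (•-closed (- 1#) v∈U)

  Annihilator : ∀ {A : Set} {n} → Pred A 0ℓ → (A → Vector Carrier n) → Pred (Vector Carrier n) 0ℓ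
  Annihilator P a u = ∀ x → P x → u · a x ≈ 0#

  annihilator-isSubspace : ∀ {A : Set} {n} (P : Pred A 0ℓ) (a : A → Vector Carrier n) →
                           IsSubspace (Annihilator P a)
  annihilator-isSubspace P a = record
    { ∈-resp-≋  = λ u≋v u⊥ x Px → trans (sym (·-congʳ (a x) u≋v)) (u⊥ x Px)
    ; 0ᵛ∈       = λ x _ → 0ᵛ-· (a x)
    ; +ᵛ-closed = λ u⊥ v⊥ x Px → trans (+ᵛ-· _ _ (a x)) (trans (+-cong (u⊥ x Px) (v⊥ x Px)) (+-identityˡ 0#))
    ; •-closed  = λ s u⊥ x Px → trans (•-· s _ (a x)) (trans (*-congˡ (u⊥ x Px)) (zeroʳ s))
    }

  combination : ∀ {n h} → Vector Carrier h → (Fin h → Vector Carrier n) → Vector Carrier n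
  combination {h = h} c f k = ∑ h (λ i → c i * f i k)

  IndependentMod : ∀ {n h} → Pred (Vector Carrier n) 0ℓ → (Fin h → Vector Carrier n) → Set
  IndependentMod U f = ∀ c → combination c f ∈ U → ∀ i → c i ≈ 0#

  combination-+ᵛ• : ∀ {n h} (c : Vector Carrier h) (f : Fin h → Vector Carrier n) (b : Vector Carrier h) p →
                    combination c (λ i → f i +ᵛ b i • p) ≋ combination c f +ᵛ (c · b) • p
  combination-+ᵛ• {h = h} c f b p k = begin
    ∑ h (λ i → c i * (f i k + b i * p k))
      ≈⟨ ∑-cong h (λ i → trans (distribˡ _ _ _) (+-congˡ (sym (*-assoc _ _ _)))) ⟩
    ∑ h (λ i → c i * f i k + c i * b i * p k)
      ≈⟨ ∑-+ h _ _ ⟩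
    combination c f k + ∑ h (λ i → c i * b i * p k)
      ≈⟨ +-congˡ (sym (*-distribʳ-∑ h (p k) _)) ⟩
    combination c f k + (c · b) * p k ∎

  module _ {n} {U : Pred (Vector Carrier n) 0ℓ} (U-sub : IsSubspace U) where
    open IsSubspace U-sub

    independent-+ᵛ-member : ∀ {h} {f : Fin h → Vector Carrier n} {p} (b : Vector Carrier h) →
                            p ∈ U → IndependentMod U f → IndependentMod U (λ i → f i +ᵛ b i • p)
    independent-+ᵛ-member {f = f} {p} b p∈U ind c cg∈U =
      ind c (∈-resp-≋ restore (+ᵛ-closed cg∈U (•-closed (- (c · b)) p∈U)))
      where
      restore : combination c (λ i → f i +ᵛ b i • p) +ᵛ (- (c · b)) • p ≋ combination c f
      restore k = begin
        combination c (λ i → f i +ᵛ b i • p) k + - (c · b) * p k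
          ≈⟨ +-cong (combination-+ᵛ• c f b p k) (sym (-‿distribˡ-* _ _)) ⟩
        combination c f k + (c · b) * p k + - ((c · b) * p k)
          ≈⟨ //-rightDividesʳ _ _ ⟩
        combination c f k ∎

    independent-+ᵛ-pivot : ∀ {h} {f : Fin (suc h) → Vector Carrier n} (i : Fin (suc h))
                           (b : Vector Carrier h) →
                           IndependentMod U f → IndependentMod U (λ j → removeAt f i j +ᵛ b j • f i)
    independent-+ᵛ-pivot {h} {f} i b ind c cg∈U j =
      trans (reflexive (≡.sym (insertAt-punchIn c i (c · b) j)))
            (ind c⁺ (∈-resp-≋ expand cg∈U) (punchIn i j))
      where
      c⁺ = insertAt c i (c · b)
      expand : combination c (λ j → removeAt f i j +ᵛ b j • f i) ≋ combination c⁺ f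
      expand k = begin
        combination c (λ j → removeAt f i j +ᵛ b j • f i) k
          ≈⟨ combination-+ᵛ• c (removeAt f i) b (f i) k ⟩
        combination c (removeAt f i) k + (c · b) * f i k
          ≈⟨ +-comm _ _ ⟩
        (c · b) * f i k + combination c (removeAt f i) k
          ≈⟨ +-cong (*-congʳ (reflexive (≡.sym (insertAt-lookup c i (c · b)))))
                    (∑-cong h (λ j → *-congʳ (reflexive (≡.sym (insertAt-punchIn c i (c · b) j))))) ⟩
        c⁺ i * f i k + ∑ h (λ j → c⁺ (punchIn i j) * f (punchIn i j) k)
          ≈⟨ sym (∑-remove h i (λ l → c⁺ l * f l k)) ⟩
        combination c⁺ f k ∎

  zeroSection : ∀ {n} → Pred (Vector Carrier (suc n)) 0ℓ → Pred (Vector Carrier n) 0ℓ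
  zeroSection U v = (0# ∷ v) ∈ U

  module _ {n} {U : Pred (Vector Carrier (suc n)) 0ℓ} (U-sub : IsSubspace U) where
    open IsSubspace U-sub

    zeroSection-isSubspace : IsSubspace (zeroSection U)
    zeroSection-isSubspace = record
      { ∈-resp-≋  = λ u≋v → ∈-resp-≋ (∀-cons refl u≋v)
      ; 0ᵛ∈       = ∈-resp-≋ (∀-cons refl (λ _ → refl)) 0ᵛ∈
      ; +ᵛ-closed = λ u∈ v∈ → ∈-resp-≋ (∀-cons (+-identityˡ 0#) (λ _ → refl)) (+ᵛ-closed u∈ v∈)
      ; •-closed  = λ s u∈ → ∈-resp-≋ (∀-cons (zeroʳ s) (λ _ → refl)) (•-closed s u∈)
      }

    independent-tail : ∀ {h} {f : Fin h → Vector Carrier (suc n)} → (∀ i → f i zero ≈ 0#) →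
                       IndependentMod U f → IndependentMod (zeroSection U) (tail ∘ f)
    independent-tail {h} {f} fᵢ₀≈0 ind c c∈ = ind c (∈-resp-≋ (∀-cons first (λ _ → refl)) c∈)
      where
      first : 0# ≈ combination c f zero
      first = sym (trans (∑-cong h (λ i → trans (*-congˡ (fᵢ₀≈0 i)) (zeroʳ (c i)))) (∑-zero h))

  eliminate : ∀ {n} → Vector Carrier (suc n) → Carrier → Vector Carrier (suc n) → Vector Carrier (suc n)
  eliminate p y v = v +ᵛ (- (v zero * y)) • p

  eliminate-zero : ∀ {n} {p : Vector Carrier (suc n)} {y} → p zero * y ≈ 1# → ∀ v → eliminate p y v zero ≈ 0#
  eliminate-zero {p = p} {y} p₀y≈1 v = begin
    v zero + - (v zero * y) * p zero   ≈⟨ +-congˡ (sym (-‿distribˡ-* _ _)) ⟩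
    v zero + - (v zero * y * p zero)   ≈⟨ +-congˡ (-‿cong v₀yp₀≈v₀) ⟩
    v zero + - v zero                  ≈⟨ -‿inverseʳ (v zero) ⟩
    0#                                 ∎
    where
    v₀yp₀≈v₀ : v zero * y * p zero ≈ v zero
    v₀yp₀≈v₀ = trans (*-assoc _ _ _)
                     (trans (*-congˡ (trans (*-comm y (p zero)) p₀y≈1)) (*-identityʳ (v zero)))

  module _ {n} {U : Pred (Vector Carrier (suc n)) 0ℓ} (U-sub : IsSubspace U) where

    independent-eliminate-member : ∀ {h} {f : Fin h → Vector Carrier (suc n)} {p y} →
      p ∈ U → p zero * y ≈ 1# → IndependentMod U f →
      IndependentMod (zeroSection U) (λ i → tail (eliminate p y (f i)))
    independent-eliminate-member {f = f} {p} {y} p∈U p₀y≈1 ind =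
      independent-tail U-sub (λ i → eliminate-zero {p = p} p₀y≈1 (f i))
        (independent-+ᵛ-member U-sub {f = f} (λ i → - (f i zero * y)) p∈U ind)

    independent-eliminate-pivot : ∀ {h} {f : Fin (suc h) → Vector Carrier (suc n)} (i : Fin (suc h)) {y} →
      f i zero * y ≈ 1# → IndependentMod U f →
      IndependentMod (zeroSection U) (λ j → tail (eliminate (f i) y (removeAt f i j)))
    independent-eliminate-pivot {f = f} i {y} fᵢ₀y≈1 ind =
      independent-tail U-sub (λ j → eliminate-zero {p = f i} fᵢ₀y≈1 (removeAt f i j))
        (independent-+ᵛ-pivot U-sub {f = f} i (λ j → - (removeAt f i j zero * y)) ind)

module Lists where
  open import Data.Nat using (zero; suc; _+_; _*_; _≤_; z≤n)
  open import Data.Nat.Properties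
    using (+-suc; *-distribʳ-+; *-monoˡ-≤; +-mono-≤; ≤-trans; module ≤-Reasoning)
  open import Data.Bool using (true; false)
  open import Data.Fin using (Fin; zero; suc)
  open import Data.List using ([]; _∷_; length; filter; map)
  open import Data.List.Relation.Unary.All as All using (All; []; _∷_)
  open import Data.List.Relation.Unary.All.Properties using (all-filter; filter⁺; map⁺)
  open import Data.List.Relation.Unary.AllPairs using (AllPairs; []; _∷_)
  open import Data.List.Relation.Binary.Sublist.Propositional.Properties using (filter-⊆; length-mono-≤)
  import Data.List.Relation.Binary.Sublist.Propositional.Properties as Sublist
  open import Data.Product using (∃; _,_)
  open import Function using (_∘_)
  open import Relation.Nullary using (does; contradiction)
  open import Relation.Binary using (Rel)
  open import Relation.Unary using (Pred; Decidable)
  open import Relation.Unary.Properties using (∁?)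
  open import Relation.Binary.PropositionalEquality using (_≡_; refl; cong; trans; sym)

  module _ {A : Set} {P : Pred A 0ℓ} (P? : Decidable P) where

    length-filter-∁ : ∀ xs → length xs ≡ length (filter P? xs) + length (filter (∁? P?) xs)
    length-filter-∁ []       = refl
    length-filter-∁ (x ∷ xs) with does (P? x)
    ... | true  = cong suc (length-filter-∁ xs)
    ... | false = trans (cong suc (length-filter-∁ xs)) (sym (+-suc _ _))

    length-filter-filter : ∀ {Q : Pred A 0ℓ} (Q? : Decidable Q) xs →
                           length (filter P? (filter Q? xs)) ≤ length (filter P? xs)
    length-filter-filter Q? xs = length-mono-≤ (Sublist.filter⁺ P? P? (λ { refl p → p }) (filter-⊆ Q? xs))

  length-≤-by-classes : ∀ {A : Set} q {c B} (P : Fin q → Pred A 0ℓ) (P? : ∀ a → Decidable (P a)) {xs} →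
                        All (λ x → ∃ λ a → P a x) xs →
                        (∀ a → length (filter (P? a) xs) * c ≤ B) →
                        length xs * c ≤ q * B
  length-≤-by-classes zero    P P? {[]}    []              bounded = z≤n
  length-≤-by-classes zero    P P? {_ ∷ _} ((() , _) ∷ _)  bounded
  length-≤-by-classes (suc q) {c} {B} P P? {xs} covered bounded = begin
    length xs * c
      ≡⟨ cong (_* c) (length-filter-∁ (P? zero) xs) ⟩
    (length (filter (P? zero) xs) + length rest) * c
      ≡⟨ *-distribʳ-+ c (length (filter (P? zero) xs)) (length rest) ⟩
    length (filter (P? zero) xs) * c + length rest * c
      ≤⟨ +-mono-≤ (bounded zero) (length-≤-by-classes q (P ∘ suc) (P? ∘ suc) covered-rest bounded-rest) ⟩
    B + q * B ∎
    where
    open ≤-Reasoning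
    rest = filter (∁? (P? zero)) xs
    covered-rest : All (λ x → ∃ λ a → P (suc a) x) rest
    covered-rest = All.zipWith
      (λ { ((zero , p) , ¬p) → contradiction p ¬p ; ((suc a , p) , _) → a , p })
      (filter⁺ (∁? (P? zero)) covered , all-filter (∁? (P? zero)) xs)
    bounded-rest : ∀ a → length (filter (P? (suc a)) rest) * c ≤ B
    bounded-rest a = ≤-trans (*-monoˡ-≤ c (length-filter-filter (P? (suc a)) (∁? (P? zero)) xs))
                             (bounded (suc a))

  AllPairs-map-within : ∀ {A B : Set} {P : Pred A 0ℓ} {R : Rel A 0ℓ} {S : Rel B 0ℓ} (g : A → B) →
                        (∀ {x y} → P x → P y → R x y → S (g x) (g y)) →
                        ∀ {xs} → All P xs → AllPairs R xs → AllPairs S (map g xs)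
  AllPairs-map-within g pres []         []         = []
  AllPairs-map-within g pres (px ∷ pxs) (rx ∷ rxs) =
    map⁺ (All.zipWith (λ (py , r) → pres px py r) (pxs , rx)) ∷ AllPairs-map-within g pres pxs rxs

module RingHomomorphism (F K : CommutativeRing 0ℓ 0ℓ)
                        (ι : CommutativeRing.Carrier F → CommutativeRing.Carrier K)
                        (hom : IsRingHom F K ι) where
  private module F = CommutativeRing F
  open CommutativeRing K
  open IsRingHom hom using (cong-ι; pres-+; pres-*; pres-1)
  open import Algebra.Properties.Ring ring using (x+x≈x⇒x≈0)
  open import Algebra.Properties.Group +-group using (inverseˡ-unique)
  open import Data.Product using (_,_)
  open import Relation.Nullary using (¬_)
  open import Relation.Binary.Reasoning.Setoid setoid

  ι-0# : ι F.0# ≈ 0#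
  ι-0# = x+x≈x⇒x≈0 _ (trans (sym (pres-+ F.0# F.0#)) (cong-ι (F.+-identityˡ F.0#)))

  ι-‿ : ∀ x → ι (F.- x) ≈ - ι x
  ι-‿ x = inverseˡ-unique _ _ (trans (sym (pres-+ _ _)) (trans (cong-ι (F.-‿inverseˡ x)) ι-0#))

  ι-- : ∀ x y → ι (x F.- y) ≈ ι x - ι y
  ι-- x y = trans (pres-+ x (F.- y)) (+-congˡ (ι-‿ y))

  ι-≉0 : IsField F → IsField K → ∀ {x} → ¬ x F.≈ F.0# → ¬ ι x ≈ 0#
  ι-≉0 F-field K-field {x} x≉0 ιx≈0 with IsField.inverse F-field x x≉0
  ... | y , xy≈1 = IsField.0≉1 K-field (begin
    0#          ≈⟨ sym (zeroˡ (ι y)) ⟩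
    0# * ι y    ≈⟨ *-congʳ ιx≈0 ⟨
    ι x * ι y   ≈⟨ pres-* x y ⟨
    ι (x F.* y) ≈⟨ cong-ι xy≈1 ⟩
    ι F.1#      ≈⟨ pres-1 ⟩
    1#          ∎)

module RationalPoints (F K : CommutativeRing 0ℓ 0ℓ) (q : ℕ) (F-finite : IsFiniteFieldOfSize F q)
                      (K-field : IsField K)
                      (ι : CommutativeRing.Carrier F → CommutativeRing.Carrier K)
                      (hom : IsRingHom F K ι) where
  open import Algebra.Properties.Group (CommutativeRing.+-group F) using (∙-cancelʳ)
  open import Algebra.Properties.Group (CommutativeRing.+-group K) using (x≈y⇒x∙y⁻¹≈ε)
  open import Data.Nat using (zero; suc; NonZero; _*_; _^_; _≤_; _≤?_; z≤n; s≤s)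
  open import Data.Nat.Properties
    using (*-commutativeSemigroup; *-monoʳ-≤; ^-monoʳ-≤; n≤1+n; ≤-refl; module ≤-Reasoning)
  open import Algebra.Properties.CommutativeSemigroup *-commutativeSemigroup using (x∙yz≈y∙xz)
  open import Data.Empty using (⊥-elim)
  open import Data.Fin using (Fin; zero; suc)
  import Data.Fin as Fin
  open import Data.Fin.Properties using (nonZeroIndex; ∀-cons)
  open import Data.List using ([]; _∷_; length; filter)
  open import Data.List.Properties using (length-map)
  open import Data.List.Relation.Unary.All as All using (All; _∷_)
  open import Data.List.Relation.Unary.All.Properties using (all-filter; filter⁺; map⁺)
  open import Data.List.Relation.Unary.AllPairs using (AllPairs; []; _∷_)
  import Data.List.Relation.Unary.AllPairs.Properties as AllPairs
  open import Data.Product using (Σ; ∃; _×_; _,_; proj₁)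
  open import Data.Vec.Functional using (Vector; tail)
  open import Function using (_∘_)
  open import Relation.Binary using (Rel; Decidable)
  open import Relation.Binary.PropositionalEquality using (subst; cong)
  open import Relation.Nullary using (¬_; yes; no; contradiction)
  open import Relation.Nullary.Decidable using (map′; decidable-stable; ¬¬-excluded-middle)
  open import Relation.Nullary.Negation using (¬¬-map; ¬∃⟶∀¬)
  open import Relation.Unary using (Pred; _∈_)

  module F = CommutativeRing F
  module K = CommutativeRing K
  open IsFiniteFieldOfSize F-finite
  open LinearAlgebra K
  open Lists
  open RingHomomorphism F K ι hom
  open IsRingHom hom using (cong-ι)

  instance
    q-nonZero : NonZero q
    q-nonZero = nonZeroIndex (proj₁ (enum-surj F.0#))

  _≟ᶠ_ : Decidable F._≈_
  x ≟ᶠ y with enum-surj x | enum-surj y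
  ... | i , eᵢ≈x | j , eⱼ≈y =
    map′ (λ i≡j → F.trans (F.sym eᵢ≈x) (F.trans (F.reflexive (cong enum i≡j)) eⱼ≈y))
         (λ x≈y → enum-inj i j (F.trans eᵢ≈x (F.trans x≈y (F.sym eⱼ≈y))))
         (i Fin.≟ j)

  ¬¬-∀-Fin : ∀ {m} {P : Pred (Fin m) 0ℓ} → (∀ i → ¬ ¬ P i) → ¬ ¬ (∀ i → P i)
  ¬¬-∀-Fin {zero}  _   ¬∀ = ¬∀ (λ ())
  ¬¬-∀-Fin {suc m} ¬¬P ¬∀ = ¬¬P zero λ P₀ → ¬¬-∀-Fin (¬¬P ∘ suc) (¬∀ ∘ ∀-cons P₀)

  Distinct : ∀ {n} → Rel (Vector F.Carrier n) 0ℓ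
  Distinct w w′ = ∃ λ k → ¬ w k F.≈ w′ k

  HasPivot : ∀ {n} → Pred (Pred (Vector K.Carrier (suc n)) 0ℓ) 0ℓ
  HasPivot U = ∃ λ p → p ∈ U × ¬ p zero K.≈ K.0#

  RationalPointBound : ℕ → Set₁
  RationalPointBound n =
    ∀ {U : Pred (Vector K.Carrier n) 0ℓ} → IsSubspace U →
    ∀ {h} {f : Fin h → Vector K.Carrier n} → IndependentMod U f →
    ∀ {ws} → AllPairs Distinct ws → All (λ w → ι ∘ w ∈ U) ws → length ws * q ^ h ≤ q ^ n

  bound-zero : RationalPointBound zero
  bound-zero _     {h = zero}  _   {[]}        _                    _ = z≤n
  bound-zero _     {h = zero}  _   {_ ∷ []}    _                    _ = s≤s z≤n
  bound-zero _     {h = zero}  _   {_ ∷ _ ∷ _} (((() , _) ∷ _) ∷ _) _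
  bound-zero U-sub {h = suc h} ind _ _ =
    ⊥-elim (IsField.0≉1 K-field (K.sym (ind (λ _ → K.1#) (∈-resp-≋ (λ ()) 0ᵛ∈) zero)))
    where open IsSubspace U-sub

  module _ {n} (IH : RationalPointBound n)
           {U : Pred (Vector K.Carrier (suc n)) 0ℓ} (U-sub : IsSubspace U) where
    open IsSubspace U-sub

    bound-fibre : ∀ {h} {f : Fin h → Vector K.Carrier n} → IndependentMod (zeroSection U) f →
                  ∀ {a ws} → All (λ w → w zero F.≈ a) ws → AllPairs Distinct ws → All (λ w → ι ∘ w ∈ U) ws →
                  length ws * q ^ h ≤ q ^ n
    bound-fibre ind {ws = []} _ _ _ = z≤n
    bound-fibre {h} ind {a} {ws = base ∷ ws} same@(base₀≈a ∷ _) dist inU@(base∈U ∷ _) =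
      subst (λ ℓ → ℓ * q ^ h ≤ q ^ n) (length-map shift (base ∷ ws))
        (IH (zeroSection-isSubspace U-sub) ind
            (AllPairs-map-within shift shift-distinct same dist)
            (map⁺ (All.zipWith (λ (w₀≈a , w∈U) → shift-∈ w₀≈a w∈U) (same , inU))))
      where
      shift : Vector F.Carrier (suc n) → Vector F.Carrier n
      shift w = tail (λ k → w k F.- base k)
      shift-∈ : ∀ {w} → w zero F.≈ a → ι ∘ w ∈ U → ι ∘ shift w ∈ zeroSection U
      shift-∈ {w} w₀≈a w∈U = ∈-resp-≋ (∀-cons first later) (-ᵛ-closed w∈U base∈U)
        where
        first : (ι ∘ w -ᵛ ι ∘ base) zero K.≈ K.0#
        first = K.trans (-ᵛ-pointwise (ι ∘ w) (ι ∘ base) zero)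
                        (x≈y⇒x∙y⁻¹≈ε (cong-ι (F.trans w₀≈a (F.sym base₀≈a))))
        later : ∀ k → (ι ∘ w -ᵛ ι ∘ base) (suc k) K.≈ ι (shift w k)
        later k = K.trans (-ᵛ-pointwise (ι ∘ w) (ι ∘ base) (suc k)) (K.sym (ι-- _ _))
      shift-distinct : ∀ {w w′} → w zero F.≈ a → w′ zero F.≈ a → Distinct w w′ → Distinct (shift w) (shift w′)
      shift-distinct w₀≈a w′₀≈a (zero  , w₀≉w′₀) = contradiction (F.trans w₀≈a (F.sym w′₀≈a)) w₀≉w′₀
      shift-distinct w₀≈a w′₀≈a (suc k , wₖ≉w′ₖ) = k , wₖ≉w′ₖ ∘ ∙-cancelʳ _ _ _

    bound-pivot : ∀ {h} {f : Fin h → Vector K.Carrier (suc n)} → IndependentMod U f →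
                  ∀ {p} → p ∈ U → ¬ p zero K.≈ K.0# →
                  ∀ {ws} → AllPairs Distinct ws → All (λ w → ι ∘ w ∈ U) ws → length ws * q ^ h ≤ q ^ suc n
    bound-pivot {h} ind {p} p∈U p₀≉0 {ws} dist inU with IsField.inverse K-field (p zero) p₀≉0
    ... | y , p₀y≈1 =
      length-≤-by-classes q InClass (λ a w → w zero ≟ᶠ enum a) (All.universal class ws) fibre-bound
      where
      InClass : Fin q → Pred (Vector F.Carrier (suc n)) 0ℓ
      InClass a w = w zero F.≈ enum a
      class : ∀ w → ∃ λ a → InClass a w
      class w with enum-surj (w zero)
      ... | a , eₐ≈w₀ = a , F.sym eₐ≈w₀
      fibre-bound : ∀ a → length (filter (λ w → w zero ≟ᶠ enum a) ws) * q ^ h ≤ q ^ n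
      fibre-bound a = bound-fibre (independent-eliminate-member U-sub p∈U p₀y≈1 ind)
        (all-filter _ ws) (AllPairs.filter⁺ _ dist) (filter⁺ _ inU)

    first-coordinates-vanish : ¬ HasPivot U → ∀ {w} → ι ∘ w ∈ U → w zero F.≈ F.0#
    first-coordinates-vanish no-pivot {w} w∈U =
      decidable-stable (w zero ≟ᶠ F.0#) (λ w₀≉0 → no-pivot (ι ∘ w , w∈U , ι-≉0 isField K-field w₀≉0))

    EliminatedFamily : ℕ → Set
    EliminatedFamily h =
      Σ ℕ λ h′ → h ≤ suc h′ × Σ (Fin h′ → Vector K.Carrier n) (IndependentMod (zeroSection U))

    eliminate-by-pivot : ∀ {h} {f : Fin h → Vector K.Carrier (suc n)} → IndependentMod U f →
                         ∀ i → ¬ f i zero K.≈ K.0# → EliminatedFamily h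
    eliminate-by-pivot {suc h} {f} ind i fᵢ₀≉0 with IsField.inverse K-field _ fᵢ₀≉0
    ... | y , fᵢ₀y≈1 = h , ≤-refl , _ , independent-eliminate-pivot U-sub {f = f} i fᵢ₀y≈1 ind

    ¬¬-eliminated-family : ∀ {h} {f : Fin h → Vector K.Carrier (suc n)} → IndependentMod U f →
                           ¬ ¬ EliminatedFamily h
    ¬¬-eliminated-family {h} {f} ind ¬family = ¬¬-excluded-middle {A = ∃ λ i → ¬ f i zero K.≈ K.0#} λ where
      (yes (i , fᵢ₀≉0)) → ¬family (eliminate-by-pivot {f = f} ind i fᵢ₀≉0)
      (no no-pivot) → ¬¬-∀-Fin (¬∃⟶∀¬ no-pivot) λ f₀≈0 →
        ¬family (h , n≤1+n h , tail ∘ f , independent-tail U-sub f₀≈0 ind)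

    bound-no-pivot : ∀ {h} {f : Fin h → Vector K.Carrier (suc n)} → IndependentMod U f →
                     ¬ HasPivot U →
                     ∀ {ws} → AllPairs Distinct ws → All (λ w → ι ∘ w ∈ U) ws →
                     ¬ ¬ (length ws * q ^ h ≤ q ^ suc n)
    bound-no-pivot {h} {f} ind no-pivot {ws} dist inU = ¬¬-map bound-from (¬¬-eliminated-family {f = f} ind)
      where
      open ≤-Reasoning
      first-coordinates-zero : All (λ w → w zero F.≈ F.0#) ws
      first-coordinates-zero = All.map (first-coordinates-vanish no-pivot) inU
      bound-from : EliminatedFamily h → length ws * q ^ h ≤ q ^ suc n
      bound-from (h′ , h≤1+h′ , _ , ind′) = begin
        length ws * q ^ h         ≤⟨ *-monoʳ-≤ (length ws) (^-monoʳ-≤ q h≤1+h′) ⟩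
        length ws * (q * q ^ h′)  ≡⟨ x∙yz≈y∙xz (length ws) q (q ^ h′) ⟩
        q * (length ws * q ^ h′)  ≤⟨ *-monoʳ-≤ q (bound-fibre ind′ first-coordinates-zero dist inU) ⟩
        q * q ^ n                 ∎

  bound : ∀ n → RationalPointBound n
  bound zero    = bound-zero
  bound (suc n) {U} U-sub ind dist inU = decidable-stable (_ ≤? _) λ ¬bound →
    ¬¬-excluded-middle {A = HasPivot U} λ where
      (yes (p , p∈U , p₀≉0)) → ¬bound (bound-pivot (bound n) U-sub ind p∈U p₀≉0 dist inU)
      (no no-pivot)          → bound-no-pivot (bound n) U-sub ind no-pivot dist inU ¬bound

open import Data.Nat using (suc; _≤_; _*_; _^_)
open import Data.Fin using (Fin)
open import Data.Vec using (Vec)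
open import Data.List using (List; length)
import Data.List as L
open import Data.List.Relation.Unary.All using (All)
open import Data.List.Relation.Unary.AllPairs using (AllPairs)
open import Data.Product using (proj₂)

lemma7 : (q : ℕ) (F K : CommutativeRing 0ℓ 0ℓ) → IsFiniteFieldOfSize F q →
         (ι : CommutativeRing.Carrier F → CommutativeRing.Carrier K) → IsAlgebraicClosure F K ι →
         (b m : ℕ) (V : ProjVariety K b) (H : ℕ) → IsHilbertValue K V m H →
         (gs : List (Form F b m)) →
         AllPairs (DistinctForms F K ι {b} {m}) gs →
         All (RestrictsToZero F K ι {b} {m} V) gs →
         length gs * q ^ H ≤ q ^ D b m
lemma7 q F K F-finite ι closure b m V H hilbert gs distinct vanishing =
  RationalPoints.bound F K q F-finite isField ι isHom (D b m)
    (LinearAlgebra.annihilator-isSubspace K (InV K V) monomialValues)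
    (proj₂ (IsHilbertValue.witness hilbert)) distinct vanishing
  where
  -- A form vanishes on V exactly when its coefficient vector annihilates the monomial values
  -- of the points of V, so IsHilbertValue's witness is independent modulo that annihilator.
  open IsAlgebraicClosure closure using (isField; isHom)
  monomialValues : Vec (CommutativeRing.Carrier K) (suc b) → Fin (D b m) → CommutativeRing.Carrier K
  monomialValues x i = monoVal K (L.lookup (monos b m) i) x
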